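{- Let $\omega$ be a real number with $\omega^2+\omega-1=0$. Let $k\ge1$ and let $H(k)$ be the half graph with color classes $\{u_1,\ldots,u_k\}$ and $\{v_1,\ldots,v_k\}$, where $u_i\sim v_j$ if and only if $j\le k-i+1$. Let $(b_1,\ldots,b_{10})=(\omega,-1,0,1,-\omega,-\omega,1,0,-1,\omega)$ and define $\mathbf{x}=(x_1,\ldots,x_k)$ by $x_i=b_s$ whenever $i\equiv s\pmod{10}$, $1\le s\le 10$. Let $\mathbf{y}$ be the vector on $V(H(k))$ with $\mathbf{y}(u_i)=\mathbf{y}(v_i)=x_i$ for $i=1,\ldots,k$. Then $\mathbf{y}$ is an eigenvector of the adjacency matrix of $H(k)$ for eigenvalue $\omega$ if $k\equiv 7\pmod{10}$, and it is an eigenvector for eigenvalue $-\omega$ if $k\equiv 2\pmod{10}$.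
   Context: Graphs are simple and undirected; the adjacency matrix $A(G)$ has $(i,j)$-entry $1$ if the $i$-th and $j$-th vertices are adjacent and $0$ otherwise. The half graph $H(k)$ is as defined in the claim. -}

module Defs where

open import Data.Nat as ℕ using (ℕ; zero; suc; _∸_; _≤ᵇ_)
open import Data.Nat.DivMod using (_mod_)
open import Data.Integer as ℤ using (ℤ; +_; -[1+_])
open import Data.Fin using (Fin; toℕ; zero; suc)
open import Data.Sum using (_⊎_; inj₁; inj₂)
open import Data.Bool using (Bool; true; false; if_then_else_)
open import Data.Product using (_×_; ∃)
open import Relation.Binary.PropositionalEquality using (_≡_)
open import Relation.Nullary using (¬_)

-- The ring ℤ[ω] ⊂ ℝ, where ω is a real root of ω² + ω − 1 = 0.
-- An element  a + b·ω  (a b : ℤ) is stored as  mk a b.  Since ω is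
-- irrational, this representation is unique, so ≡ is real equality.

record ℤω : Set where
  constructor mk
  field
    re : ℤ
    om : ℤ

0ω 1ω ω : ℤω
0ω = mk (+ 0) (+ 0)
1ω = mk (+ 1) (+ 0)
ω  = mk (+ 0) (+ 1)

_+ω_ : ℤω → ℤω → ℤω
mk a b +ω mk c d = mk (a ℤ.+ c) (b ℤ.+ d)

-ω_ : ℤω → ℤω
-ω (mk a b) = mk (ℤ.- a) (ℤ.- b)

-- (a + bω)(c + dω) = ac + (ad + bc)ω + bd ω² = (ac + bd) + (ad + bc − bd)ω
_*ω_ : ℤω → ℤω → ℤω
mk a b *ω mk c d = mk (a ℤ.* c ℤ.+ b ℤ.* d) (a ℤ.* d ℤ.+ b ℤ.* c ℤ.- b ℤ.* d)

sumFin : (n : ℕ) → (Fin n → ℤω) → ℤω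
sumFin zero    f = 0ω
sumFin (suc n) f = f zero +ω sumFin n (λ i → f (suc i))

-- The half graph H(k).
-- Vertex set: inj₁ i is u_{i+1}, inj₂ j is v_{j+1}  (i j : Fin k, 0-based).
-- u_i ~ v_j  iff  j ≤ k − i + 1  (1-based indices as in the paper).

V : ℕ → Set
V k = Fin k ⊎ Fin k

halfAdj : (k : ℕ) → V k → V k → Bool
halfAdj k (inj₁ i) (inj₁ j) = false
halfAdj k (inj₂ i) (inj₂ j) = false
halfAdj k (inj₁ i) (inj₂ j) = suc (toℕ j) ≤ᵇ (k ∸ suc (toℕ i)) ℕ.+ 1
halfAdj k (inj₂ j) (inj₁ i) = suc (toℕ j) ≤ᵇ (k ∸ suc (toℕ i)) ℕ.+ 1

A : (k : ℕ) → V k → V k → ℤω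
A k w w' = if halfAdj k w w' then 1ω else 0ω

sumV : (k : ℕ) → (V k → ℤω) → ℤω
sumV k f = sumFin k (λ i → f (inj₁ i)) +ω sumFin k (λ j → f (inj₂ j))

mulVec : (k : ℕ) → (V k → V k → ℤω) → (V k → ℤω) → V k → ℤω
mulVec k M y w = sumV k (λ w' → M w w' *ω y w')

IsEigenvector : (k : ℕ) → (V k → V k → ℤω) → (V k → ℤω) → ℤω → Set
IsEigenvector k M y λ' =
  ¬ (∀ w → y w ≡ 0ω) × (∀ w → mulVec k M y w ≡ λ' *ω y w)

-- (b_1,…,b_10) = (ω,−1,0,1,−ω,−ω,1,0,−1,ω), stored 0-based: b s = b_{s+1}

b : Fin 10 → ℤω
b zero = ω
b (suc zero) = -ω 1ω
b (suc (suc zero)) = 0ω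
b (suc (suc (suc zero))) = 1ω
b (suc (suc (suc (suc zero)))) = -ω ω
b (suc (suc (suc (suc (suc zero))))) = -ω ω
b (suc (suc (suc (suc (suc (suc zero)))))) = 1ω
b (suc (suc (suc (suc (suc (suc (suc zero))))))) = 0ω
b (suc (suc (suc (suc (suc (suc (suc (suc zero)))))))) = -ω 1ω
b (suc (suc (suc (suc (suc (suc (suc (suc (suc zero)))))))))  = ω

-- x_i = b_s where i ≡ s (mod 10), 1 ≤ s ≤ 10 (i 1-based), i.e. s = ((i−1) mod 10) + 1.
-- Here i is given 0-based as i' = i − 1, so x = b (i' mod 10).
x : (k : ℕ) → Fin k → ℤω
x k i = b (toℕ i mod 10)

y : (k : ℕ) → V k → ℤω
y k (inj₁ i) = x k i
y k (inj₂ i) = x k i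

-- A applied to a vector taking the same value on u_i and v_i gives, at both u_i and v_i, the
-- prefix sum of the first k − i + 1 entries, because u_i and v_j are adjacent exactly when
-- i + j ≤ k + 1.  The pattern b sums to 0, so these prefix sums are 10-periodic, and the
-- eigen-equation (A y)(u_i) = λ x_i becomes an identity between residues of k − i + 1 and i
-- modulo 10; for k ≡ 7 and k ≡ 2 these are finitely many identities in ℤ[ω], checked by
-- computation.
module Submission where

open import Defs
open import Data.Nat using (ℕ; _≟_; zero; suc; _+_; _*_; _∸_; _≤_; _<_; _≤ᵇ_; _%_; _/_; NonZero)
open import Data.Nat.Properties
  using (+-identityʳ; +-suc; +-assoc; +-comm; +-∸-assoc; m+[n∸m]≡n; m∸n+n≡m; m≤m+n; +-monoʳ-<;
         m+n≤o⇒m≤o∸n; m≤o∸n⇒m+n≤o; <⇒≤; <-≤-trans; ≤⇒≯; m∸n≤m; ≤⇒≤ᵇ; ≤ᵇ⇒≤; m<n⇒m<1+n; n<1+n)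
open import Data.Nat.DivMod using (_mod_; m≡m%n+[m/n]*n; m%n%n≡m%n; m%n<n; %-distribˡ-+)
import Data.Integer.Properties as ℤ
open import Data.Fin as Fin using (Fin; toℕ; zero)
open import Data.Fin.Properties using (toℕ-fromℕ<; fromℕ<-cong; toℕ<n; all?)
open import Data.Sum using (inj₁; inj₂)
open import Data.Bool using (Bool; true; false; if_then_else_; T)
open import Data.Product using (_×_; _,_)
open import Data.Unit using (tt)
open import Data.Empty using (⊥-elim)
open import Function using (_∘_)
open import Relation.Nullary using (¬_; Dec)
open import Relation.Nullary.Decidable using (map′; _×-dec_; _→-dec_; toWitness)
open import Relation.Binary.Definitions using (DecidableEquality)
open import Relation.Binary.PropositionalEquality
open ≡-Reasoning

+ω-assoc : ∀ p q r → (p +ω q) +ω r ≡ p +ω (q +ω r)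
+ω-assoc (mk a b) (mk c d) (mk e f) = cong₂ mk (ℤ.+-assoc a c e) (ℤ.+-assoc b d f)

+ω-identityˡ : ∀ p → 0ω +ω p ≡ p
+ω-identityˡ (mk a b) = cong₂ mk (ℤ.+-identityˡ a) (ℤ.+-identityˡ b)

+ω-identityʳ : ∀ p → p +ω 0ω ≡ p
+ω-identityʳ (mk a b) = cong₂ mk (ℤ.+-identityʳ a) (ℤ.+-identityʳ b)

*ω-identityˡ : ∀ p → 1ω *ω p ≡ p
*ω-identityˡ (mk a b) rewrite ℤ.*-identityˡ a | ℤ.*-identityˡ b | ℤ.*-zeroˡ a | ℤ.*-zeroˡ b
  | ℤ.+-identityʳ a | ℤ.+-identityʳ b | ℤ.+-identityʳ b = refl

*ω-zeroˡ : ∀ p → 0ω *ω p ≡ 0ω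
*ω-zeroˡ (mk a b) rewrite ℤ.*-zeroˡ a | ℤ.*-zeroˡ b = refl

infix 4 _≟ω_

_≟ω_ : DecidableEquality ℤω
mk a b ≟ω mk c d =
  map′ (λ (a≡c , b≡d) → cong₂ mk a≡c b≡d) (λ { refl → refl , refl }) (a ℤ.≟ c ×-dec b ℤ.≟ d)

indicator-*ω : ∀ c p → (if c then 1ω else 0ω) *ω p ≡ (if c then p else 0ω)
indicator-*ω true  p = *ω-identityˡ p
indicator-*ω false p = *ω-zeroˡ p

sumFin-zero : ∀ n (f : Fin n → ℤω) → sumFin n (λ i → 0ω *ω f i) ≡ 0ω
sumFin-zero zero    f = refl
sumFin-zero (suc n) f =
  trans (cong₂ _+ω_ (*ω-zeroˡ (f zero)) (sumFin-zero n (λ i → f (Fin.suc i)))) (+ω-identityˡ 0ω)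

prefix : (ℕ → ℤω) → ℕ → ℤω
prefix f zero    = 0ω
prefix f (suc n) = prefix f n +ω f n

prefix-cong : ∀ {f g} n → (∀ j → j < n → f j ≡ g j) → prefix f n ≡ prefix g n
prefix-cong zero    f≡g = refl
prefix-cong (suc n) f≡g =
  cong₂ _+ω_ (prefix-cong n (λ j j<n → f≡g j (m<n⇒m<1+n j<n))) (f≡g n (n<1+n n))

prefix-zero : ∀ n → prefix (λ _ → 0ω) n ≡ 0ω
prefix-zero zero    = refl
prefix-zero (suc n) = trans (+ω-identityʳ _) (prefix-zero n)

prefix-+ : ∀ f m n → prefix f (m + n) ≡ prefix f m +ω prefix (λ j → f (m + j)) n
prefix-+ f m zero rewrite +-identityʳ m = sym (+ω-identityʳ (prefix f m))
prefix-+ f m (suc n) rewrite +-suc m n = begin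
  prefix f (m + n) +ω f (m + n)                                       ≡⟨ cong (_+ω f (m + n)) (prefix-+ f m n) ⟩
  (prefix f m +ω prefix (λ j → f (m + j)) n) +ω f (m + n)            ≡⟨ +ω-assoc (prefix f m) _ (f (m + n)) ⟩
  prefix f m +ω (prefix (λ j → f (m + j)) n +ω f (m + n))            ∎

sumFin-toℕ : ∀ n f → sumFin n (λ i → f (toℕ i)) ≡ prefix f n
sumFin-toℕ zero    f = refl
sumFin-toℕ (suc n) f = begin
  f 0 +ω sumFin n (λ i → f (suc (toℕ i)))    ≡⟨ cong (f 0 +ω_) (sumFin-toℕ n (λ j → f (suc j))) ⟩
  f 0 +ω prefix (λ j → f (suc j)) n          ≡⟨ cong (_+ω prefix (λ j → f (suc j)) n) (sym (+ω-identityˡ (f 0))) ⟩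
  prefix f 1 +ω prefix (λ j → f (1 + j)) n   ≡⟨ sym (prefix-+ f 1 n) ⟩
  prefix f (suc n)                           ∎

if-T : ∀ {c} {p q : ℤω} → T c → (if c then p else q) ≡ p
if-T {true} _ = refl

if-¬T : ∀ {c} {p q : ℤω} → ¬ T c → (if c then p else q) ≡ q
if-¬T {true}  ¬t = ⊥-elim (¬t tt)
if-¬T {false} _  = refl

prefix-filter : ∀ (c : ℕ → Bool) f {m n} → m ≤ n →
                (∀ j → j < m → T (c j)) → (∀ j → j < n → T (c j) → j < m) →
                prefix (λ j → if c j then f j else 0ω) n ≡ prefix f m
prefix-filter c f {m} {n} m≤n below above = begin
  prefix g n                                           ≡⟨ cong (prefix g) (sym (m+[n∸m]≡n m≤n)) ⟩
  prefix g (m + (n ∸ m))                               ≡⟨ prefix-+ g m (n ∸ m) ⟩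
  prefix g m +ω prefix (λ j → g (m + j)) (n ∸ m)       ≡⟨ cong₂ _+ω_ (prefix-cong m (λ j j<m → if-T (below j j<m)))
                                                                     (prefix-cong (n ∸ m) (λ j → if-¬T ∘ outside j)) ⟩
  prefix f m +ω prefix (λ _ → 0ω) (n ∸ m)              ≡⟨ cong (prefix f m +ω_) (prefix-zero (n ∸ m)) ⟩
  prefix f m +ω 0ω                                     ≡⟨ +ω-identityʳ (prefix f m) ⟩
  prefix f m                                           ∎
  where
  g : ℕ → ℤω
  g j = if c j then f j else 0ω
  outside : ∀ j → j < n ∸ m → ¬ T (c (m + j))
  outside j j<n∸m t = ≤⇒≯ (m≤m+n m j) (above (m + j) m+j<n t)
    where m+j<n = subst (m + j <_) (m+[n∸m]≡n m≤n) (+-monoʳ-< m j<n∸m)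

adjacent : ℕ → ℕ → ℕ → Bool
adjacent k m n = suc n ≤ᵇ (k ∸ suc m) + 1

k∸[1+m]+1≡k∸m : ∀ {k m} → m < k → k ∸ suc m + 1 ≡ k ∸ m
k∸[1+m]+1≡k∸m {k} {m} m<k = trans (+-comm (k ∸ suc m) 1) (sym (+-∸-assoc 1 m<k))

adjacent⇒< : ∀ {k m n} → m < k → T (adjacent k m n) → n < k ∸ m
adjacent⇒< {k} {m} {n} m<k t = subst (suc n ≤_) (k∸[1+m]+1≡k∸m m<k) (≤ᵇ⇒≤ (suc n) _ t)

<⇒adjacent : ∀ {k m n} → m < k → n < k ∸ m → T (adjacent k m n)
<⇒adjacent {k} {m} {n} m<k n<k∸m = ≤⇒≤ᵇ (subst (suc n ≤_) (sym (k∸[1+m]+1≡k∸m m<k)) n<k∸m)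

<-∸-swap : ∀ {i j k} → j ≤ k → i < k ∸ j → j < k ∸ i
<-∸-swap {i} {j} {k} j≤k i<k∸j =
  m+n≤o⇒m≤o∸n (suc j) (subst (_≤ k) (cong suc (+-comm i j)) (m≤o∸n⇒m+n≤o (suc i) j≤k i<k∸j))

row-sum : ∀ k (c : ℕ → Bool) f {m} → m ≤ k →
          (∀ j → j < m → T (c j)) → (∀ j → j < k → T (c j) → j < m) →
          sumFin k (λ j → (if c (toℕ j) then 1ω else 0ω) *ω f (toℕ j)) ≡ prefix f m
row-sum k c f m≤k below above = begin
  sumFin k (λ j → (if c (toℕ j) then 1ω else 0ω) *ω f (toℕ j))
                                                      ≡⟨ sumFin-toℕ k (λ j → (if c j then 1ω else 0ω) *ω f j) ⟩
  prefix (λ j → (if c j then 1ω else 0ω) *ω f j) k   ≡⟨ prefix-cong k (λ j _ → indicator-*ω (c j) (f j)) ⟩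
  prefix (λ j → if c j then f j else 0ω) k            ≡⟨ prefix-filter c f m≤k below above ⟩
  prefix f _                                          ∎

symmetric : ∀ k → (ℕ → ℤω) → V k → ℤω
symmetric k f (inj₁ i) = f (toℕ i)
symmetric k f (inj₂ i) = f (toℕ i)

index : ∀ {k} → V k → ℕ
index (inj₁ i) = toℕ i
index (inj₂ i) = toℕ i

mulVec-symmetric : ∀ k f w → mulVec k (A k) (symmetric k f) w ≡ prefix f (k ∸ index w)
mulVec-symmetric k f (inj₁ i) = begin
  sumFin k (λ j → 0ω *ω f (toℕ j)) +ω sumFin k (λ j → A k (inj₁ i) (inj₂ j) *ω f (toℕ j))
    ≡⟨ cong₂ _+ω_ (sumFin-zero k (λ j → f (toℕ j)))
                  (row-sum k (adjacent k (toℕ i)) f (m∸n≤m k (toℕ i))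
                     (λ j → <⇒adjacent (toℕ<n i)) (λ j _ → adjacent⇒< (toℕ<n i))) ⟩
  0ω +ω prefix f (k ∸ toℕ i)
    ≡⟨ +ω-identityˡ (prefix f (k ∸ toℕ i)) ⟩
  prefix f (k ∸ toℕ i)
    ∎
mulVec-symmetric k f (inj₂ i) = begin
  sumFin k (λ j → A k (inj₂ i) (inj₁ j) *ω f (toℕ j)) +ω sumFin k (λ j → 0ω *ω f (toℕ j))
    ≡⟨ cong₂ _+ω_ (row-sum k (λ j → adjacent k j (toℕ i)) f (m∸n≤m k (toℕ i)) below above)
                  (sumFin-zero k (λ j → f (toℕ j))) ⟩
  prefix f (k ∸ toℕ i) +ω 0ω
    ≡⟨ +ω-identityʳ (prefix f (k ∸ toℕ i)) ⟩
  prefix f (k ∸ toℕ i)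
    ∎
  where
  below : ∀ j → j < k ∸ toℕ i → T (adjacent k j (toℕ i))
  below j j<k∸i = <⇒adjacent j<k (<-∸-swap (<⇒≤ (toℕ<n i)) j<k∸i)
    where j<k = <-≤-trans j<k∸i (m∸n≤m k (toℕ i))
  above : ∀ j → j < k → T (adjacent k j (toℕ i)) → j < k ∸ toℕ i
  above j j<k t = <-∸-swap (<⇒≤ j<k) (adjacent⇒< j<k t)

prefix-periodic : ∀ f p → (∀ j → f (p + j) ≡ f j) → prefix f p ≡ 0ω →
                  ∀ n → prefix f (p + n) ≡ prefix f n
prefix-periodic f p f-periodic period≡0 n = begin
  prefix f (p + n)                           ≡⟨ prefix-+ f p n ⟩
  prefix f p +ω prefix (λ j → f (p + j)) n   ≡⟨ cong₂ _+ω_ period≡0 (prefix-cong n (λ j _ → f-periodic j)) ⟩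
  0ω +ω prefix f n                           ≡⟨ +ω-identityˡ (prefix f n) ⟩
  prefix f n                                 ∎

prefix-% : ∀ f p .{{_ : NonZero p}} → (∀ j → f (p + j) ≡ f j) → prefix f p ≡ 0ω →
           ∀ n → prefix f n ≡ prefix f (n % p)
prefix-% f p f-periodic period≡0 n = begin
  prefix f n                      ≡⟨ cong (prefix f) (trans (m≡m%n+[m/n]*n n p) (+-comm (n % p) (n / p * p))) ⟩
  prefix f (n / p * p + n % p)    ≡⟨ drop-periods (n / p) ⟩
  prefix f (n % p)                ∎
  where
  drop-periods : ∀ q {t} → prefix f (q * p + t) ≡ prefix f t
  drop-periods zero        = refl
  drop-periods (suc q) {t} = begin
    prefix f (p + q * p + t)     ≡⟨ cong (prefix f) (+-assoc p (q * p) t) ⟩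
    prefix f (p + (q * p + t))   ≡⟨ prefix-periodic f p f-periodic period≡0 (q * p + t) ⟩
    prefix f (q * p + t)         ≡⟨ drop-periods q ⟩
    prefix f t                   ∎

toℕ-mod : ∀ n → toℕ (n mod 10) ≡ n % 10
toℕ-mod n = toℕ-fromℕ< (m%n<n n 10)

x̂ : ℕ → ℤω
x̂ n = b (n mod 10)

x̂-% : ∀ n → x̂ (n % 10) ≡ x̂ n
x̂-% n = cong b (fromℕ<-cong _ _ (m%n%n≡m%n n 10) _ _)

-- Both hypotheses hold by computation: (10 + j) % 10 reduces to j % 10, and b sums to 0.
prefix-x̂-% : ∀ n → prefix x̂ n ≡ prefix x̂ (n % 10)
prefix-x̂-% = prefix-% x̂ 10 (λ _ → refl) refl

-- For n = k ∸ i this is the eigen-equation at u_{i+1} and v_{i+1}, for every k ≡ r (mod 10).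
Dual : ℕ → ℤω → Set
Dual r θ = ∀ n i → (n + i) % 10 ≡ r → prefix x̂ n ≡ θ *ω x̂ i

DualOnResidues : ℕ → ℤω → Set
DualOnResidues r θ =
  ∀ (t s : Fin 10) → (toℕ t + toℕ s) % 10 ≡ r → prefix x̂ (toℕ t) ≡ θ *ω x̂ (toℕ s)

dualOnResidues? : ∀ r θ → Dec (DualOnResidues r θ)
dualOnResidues? r θ = all? λ t → all? λ s →
  ((toℕ t + toℕ s) % 10 ≟ r) →-dec (prefix x̂ (toℕ t) ≟ω θ *ω x̂ (toℕ s))

dualOnResidues⇒dual : ∀ r θ → DualOnResidues r θ → Dual r θ
dualOnResidues⇒dual r θ table n i n+i≡r = begin
  prefix x̂ n                   ≡⟨ prefix-x̂-% n ⟩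
  prefix x̂ (n % 10)            ≡⟨ cong (prefix x̂) (sym (toℕ-mod n)) ⟩
  prefix x̂ (toℕ (n mod 10))    ≡⟨ table (n mod 10) (i mod 10) residues ⟩
  θ *ω x̂ (toℕ (i mod 10))      ≡⟨ cong (λ s → θ *ω x̂ s) (toℕ-mod i) ⟩
  θ *ω x̂ (i % 10)              ≡⟨ cong (θ *ω_) (x̂-% i) ⟩
  θ *ω x̂ i                     ∎
  where
  residues : (toℕ (n mod 10) + toℕ (i mod 10)) % 10 ≡ r
  residues = begin
    (toℕ (n mod 10) + toℕ (i mod 10)) % 10   ≡⟨ cong₂ (λ a c → (a + c) % 10) (toℕ-mod n) (toℕ-mod i) ⟩
    (n % 10 + i % 10) % 10                   ≡⟨ sym (%-distribˡ-+ n i 10) ⟩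
    (n + i) % 10                             ≡⟨ n+i≡r ⟩
    r                                        ∎

dual₇ : Dual 7 ω
dual₇ = dualOnResidues⇒dual 7 ω (toWitness {a? = dualOnResidues? 7 ω} tt)

dual₂ : Dual 2 (-ω ω)
dual₂ = dualOnResidues⇒dual 2 (-ω ω) (toWitness {a? = dualOnResidues? 2 (-ω ω)} tt)

y≢0 : ∀ k → 1 ≤ k → ¬ (∀ w → y k w ≡ 0ω)
y≢0 (suc k) _ y≡0 with y≡0 (inj₁ zero)
... | ()

dual-row : ∀ {k} r θ → k % 10 ≡ r → Dual r θ → ∀ {i} → i < k → prefix x̂ (k ∸ i) ≡ θ *ω x̂ i
dual-row {k} r θ k≡r dual {i} i<k = dual (k ∸ i) i (trans (cong (_% 10) (m∸n+n≡m (<⇒≤ i<k))) k≡r)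

eigen-equation : ∀ k r θ → k % 10 ≡ r → Dual r θ → ∀ w → mulVec k (A k) (y k) w ≡ θ *ω y k w
eigen-equation k r θ k≡r dual (inj₁ i) = trans (mulVec-symmetric k x̂ (inj₁ i)) (dual-row r θ k≡r dual (toℕ<n i))
eigen-equation k r θ k≡r dual (inj₂ i) = trans (mulVec-symmetric k x̂ (inj₂ i)) (dual-row r θ k≡r dual (toℕ<n i))

theorem3p5 : (k : ℕ) → 1 ≤ k →
    (k % 10 ≡ 7 → IsEigenvector k (A k) (y k) ω)
    × (k % 10 ≡ 2 → IsEigenvector k (A k) (y k) (-ω ω))
theorem3p5 k 1≤k =
  (λ k≡7 → y≢0 k 1≤k , eigen-equation k 7 ω k≡7 dual₇) ,
  (λ k≡2 → y≢0 k 1≤k , eigen-equation k 2 (-ω ω) k≡2 dual₂)
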